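{- For every positive integer $N$ there exist graphs $G$ and $H$ such that $H$ is a supergraph of $G$ and $F(G)-F(H)\geq N$. That is, $F(G)-F(H)$ can be made arbitrarily large over pairs of a graph $G$ and a supergraph $H$ of $G$.
   Context: All graphs are finite and simple. $H$ is a supergraph of $G$ if $V(G)\subseteq V(H)$ and $E(G)\subseteq E(H)$. Given a graph $G$ and a set $S\subseteq V(G)$, the forcing rule is: if a vertex $v\in S$ has exactly one neighbor $u$ not in $S$, then $u$ is added to $S$. A set $S$ is a failed zero-forcing set of $G$ if repeated application of the forcing rule starting from $S$ does not result in all vertices of $G$ being in $S$. The failed zero-forcing number $F(G)$ is the maximum cardinality of a failed zero-forcing set of $G$. -}

module Defs where

open import Data.Nat using (ℕ; _≤_)
open import Data.Bool using (Bool; true; false)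
open import Data.Fin using (Fin; inject≤)
open import Data.Fin.Subset using (Subset; _∈_; _∉_; ∣_∣)
open import Data.Product using (Σ; ∃; _×_; _,_)
open import Relation.Binary.PropositionalEquality using (_≡_; _≢_)
open import Relation.Nullary using (¬_)

record Graph (n : ℕ) : Set where
  field
    adj    : Fin n → Fin n → Bool
    sym    : ∀ i j → adj i j ≡ adj j i
    irrefl : ∀ i → adj i i ≡ false
open Graph public

Adj : ∀ {n} → Graph n → Fin n → Fin n → Set
Adj G i j = adj G i j ≡ true

-- H (on Fin m) is a supergraph of G (on Fin n): the vertex i of G is the
-- vertex inject≤ i of H (so V(G) ⊆ V(H)), and every edge of G is an edge of H.
IsSupergraph : ∀ {n m} → Graph n → Graph m → Set
IsSupergraph {n} {m} G H =
  Σ (n ≤ m) λ n≤m → ∀ i j → Adj G i j → Adj H (inject≤ i n≤m) (inject≤ j n≤m)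

data Forced {n} (G : Graph n) (S : Subset n) : Fin n → Set where
  init  : ∀ {v} → v ∈ S → Forced G S v
  force : ∀ {w u} → Forced G S w → Adj G w u →
          (∀ x → Adj G w x → x ≢ u → Forced G S x) → Forced G S u

FailedZF : ∀ {n} → Graph n → Subset n → Set
FailedZF G S = ∃ λ v → ¬ Forced G S v

IsFailedZFNumber : ∀ {n} → Graph n → ℕ → Set
IsFailedZFNumber {n} G k =
  (∃ λ (S : Subset n) → FailedZF G S × ∣ S ∣ ≡ k) ×
  (∀ (S : Subset n) → FailedZF G S → ∣ S ∣ ≤ k)

{-# OPTIONS --safe #-}
-- In an edgeless graph nothing is ever forced, so every set missing one vertex
-- fails and F = n - 1.  Adding the edges of the path P(2k+1) drops F to k: in a
-- path two consecutive forced vertices, or a forced end vertex, propagate along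
-- the whole path, so a failed set contains no two consecutive vertices and avoids
-- the first vertex, giving at most k vertices; conversely the odd-indexed vertices
-- fail, since each of them has both of its neighbours outside the set.
module Submission where

open import Defs hiding (sym)
open import Data.Nat using (ℕ; zero; suc; _+_; _*_; _≤_; _<_; _≥_; _≡ᵇ_; ⌈_/2⌉; z≤n; s≤s; s≤s⁻¹)
open import Data.Nat.Properties
  using (≤-refl; ≤-reflexive; ≤-trans; <-trans; n<1+n; n≤1+n; suc-injective; 1+n≢0; m≢1+n+m;
         ≡ᵇ⇒≡; ≡⇒≡ᵇ; ⌈n/2⌉-mono; n≡⌈n+n/2⌉; *-comm; +-identityʳ)
open import Data.Bool using (Bool; false; _∨_)
open import Data.Bool.Properties using (∨-comm; T-≡; T-∨)
open import Data.Fin using (Fin; zero; suc; toℕ; fromℕ<)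
open import Data.Fin.Properties using (toℕ-injective; toℕ-fromℕ<; toℕ<n)
open import Data.Fin.Subset using (Subset; _∈_; _∉_; ∣_∣; ⊤; outside; inside)
open import Data.Fin.Subset.Properties using (_∈?_; ∈⊤; ⊆⊤; ∣⊤∣≡n; p⊂q⇒∣p∣<∣q∣)
open import Data.Vec using ([]; _∷_; here; there)
open import Data.Product using (Σ; ∃; ∃₂; _×_; _,_; proj₁)
open import Data.Sum using (_⊎_; inj₁; inj₂; [_,_])
import Data.Sum as Sum
open import Data.Empty using (⊥-elim)
open import Function using (_∘_; Equivalence)
open import Relation.Binary.PropositionalEquality using (_≡_; _≢_; refl; sym; trans; cong; subst)
open import Relation.Nullary using (yes; no; contradiction)

private
  variable
    n : ℕ
    S : Subset n

Stalled : Graph n → Subset n → Set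
Stalled G S =
  ∀ {w u} → w ∈ S → Adj G w u → u ∉ S → ∃ λ v → Adj G w v × v ≢ u × v ∉ S

stalled⇒forced⊆ : ∀ {G : Graph n} {x} → Stalled G S → Forced G S x → x ∈ S
stalled⇒forced⊆ stalled (init x∈S) = x∈S
stalled⇒forced⊆ {S = S} stalled (force {u = u} fw wu others) with u ∈? S
... | yes u∈S = u∈S
... | no u∉S with stalled (stalled⇒forced⊆ stalled fw) wu u∉S
...   | v , wv , v≢u , v∉S = contradiction (stalled⇒forced⊆ stalled (others v wv v≢u)) v∉S

stalled⇒failed : ∀ {G : Graph n} {x} → Stalled G S → x ∉ S → FailedZF G S
stalled⇒failed stalled x∉S = _ , x∉S ∘ stalled⇒forced⊆ stalled

failed⇒∣S∣<n : ∀ {G : Graph n} → FailedZF G S → ∣ S ∣ < n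
failed⇒∣S∣<n {n = n} {S = S} (v , unforced) =
  subst (∣ S ∣ <_) (∣⊤∣≡n n) (p⊂q⇒∣p∣<∣q∣ (⊆⊤ , v , ∈⊤ , unforced ∘ init))

edgeless : ∀ n → Graph n
edgeless n = record { adj = λ _ _ → false ; sym = λ _ _ → refl ; irrefl = λ _ → refl }

edgeless-isSupergraph : (H : Graph n) → IsSupergraph (edgeless n) H
edgeless-isSupergraph _ = ≤-refl , λ _ _ ()

edgeless-failedZFNumber : ∀ n → IsFailedZFNumber (edgeless (suc n)) n
edgeless-failedZFNumber n =
  (outside ∷ ⊤ , stalled⇒failed {x = zero} (λ _ ()) (λ ()) , ∣⊤∣≡n n) ,
  λ S failed → s≤s⁻¹ (failed⇒∣S∣<n failed)

consecutive : ℕ → ℕ → Bool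
consecutive i j = (suc i ≡ᵇ j) ∨ (suc j ≡ᵇ i)

consecutive-irrefl : ∀ i → consecutive i i ≡ false
consecutive-irrefl zero    = refl
consecutive-irrefl (suc i) = consecutive-irrefl i

path : ∀ n → Graph n
path n = record
  { adj    = λ i j → consecutive (toℕ i) (toℕ j)
  ; sym    = λ i j → ∨-comm (suc (toℕ i) ≡ᵇ toℕ j) _
  ; irrefl = consecutive-irrefl ∘ toℕ
  }

path-adj⁺ : ∀ {i j : Fin n} → suc (toℕ i) ≡ toℕ j → Adj (path n) i j
path-adj⁺ e = Equivalence.to T-≡ (Equivalence.from T-∨ (inj₁ (≡⇒≡ᵇ _ _ e)))

path-adj⁻ : ∀ {i j : Fin n} → suc (toℕ i) ≡ toℕ j → Adj (path n) j i
path-adj⁻ {i = i} {j} e = trans (∨-comm (suc (toℕ j) ≡ᵇ toℕ i) _) (path-adj⁺ e)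

path-adj⇒consecutive : ∀ {i j : Fin n} → Adj (path n) i j →
                       suc (toℕ i) ≡ toℕ j ⊎ suc (toℕ j) ≡ toℕ i
path-adj⇒consecutive adj =
  Sum.map (≡ᵇ⇒≡ _ _) (≡ᵇ⇒≡ _ _) (Equivalence.to T-∨ (Equivalence.from T-≡ adj))

path-neighbours : ∀ {a w c x : Fin n} → suc (toℕ a) ≡ toℕ w → suc (toℕ w) ≡ toℕ c →
                  Adj (path n) w x → x ≡ a ⊎ x ≡ c
path-neighbours aw wc adj with path-adj⇒consecutive adj
... | inj₁ wx = inj₂ (toℕ-injective (trans (sym wx) wc))
... | inj₂ xw = inj₁ (toℕ-injective (suc-injective (trans xw (sym aw))))

vertexAt : ∀ {j} → j < n → ∃ λ (x : Fin n) → toℕ x ≡ j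
vertexAt j<n = fromℕ< j<n , toℕ-fromℕ< j<n

module PathForcing (S : Subset n) where

  ForcedAt : ℕ → Set
  ForcedAt j = ∀ x → toℕ x ≡ j → Forced (path n) S x

  forced-next : ∀ {a w c} → suc (toℕ a) ≡ toℕ w → suc (toℕ w) ≡ toℕ c →
                Forced (path n) S a → Forced (path n) S w → Forced (path n) S c
  forced-next aw wc fa fw = force fw (path-adj⁺ wc) λ x wx x≢c →
    [ (λ x≡a → subst (Forced (path n) S) (sym x≡a) fa) , ⊥-elim ∘ x≢c ]
      (path-neighbours aw wc wx)

  forced-prev : ∀ {a w c} → suc (toℕ a) ≡ toℕ w → suc (toℕ w) ≡ toℕ c →
                Forced (path n) S w → Forced (path n) S c → Forced (path n) S a
  forced-prev aw wc fw fc = force fw (path-adj⁻ aw) λ x wx x≢a →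
    [ ⊥-elim ∘ x≢a , (λ x≡c → subst (Forced (path n) S) (sym x≡c) fc) ]
      (path-neighbours aw wc wx)

  forcedAt-next : ∀ {j} → ForcedAt j → ForcedAt (suc j) → ForcedAt (suc (suc j))
  forcedAt-next {j} fj fj′ c c≡ with vertexAt (<-trans (n<1+n j) b<n) | vertexAt b<n
    where b<n = <-trans (n<1+n (suc j)) (subst (_< n) c≡ (toℕ<n c))
  ... | a , a≡ | b , b≡ =
    forced-next (trans (cong suc a≡) (sym b≡)) (trans (cong suc b≡) (sym c≡)) (fj a a≡) (fj′ b b≡)

  forcedAt-prev : ∀ {j} → suc (suc j) < n →
                  ForcedAt (suc j) → ForcedAt (suc (suc j)) → ForcedAt j
  forcedAt-prev {j} c<n fj′ fj″ a a≡ with vertexAt (<-trans (n<1+n (suc j)) c<n) | vertexAt c<n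
  ... | b , b≡ | c , c≡ =
    forced-prev (trans (cong suc a≡) (sym b≡)) (trans (cong suc b≡) (sym c≡)) (fj′ b b≡) (fj″ c c≡)

  forcedAt-one : ForcedAt 0 → ForcedAt 1
  forcedAt-one f₀ u u≡ with vertexAt (≤-trans (s≤s z≤n) (toℕ<n u))
  ... | z , z≡ = force (f₀ z z≡) (path-adj⁺ zu) λ x zx x≢u →
    [ (λ zx′ → ⊥-elim (x≢u (toℕ-injective (trans (sym zx′) zu))))
    , (λ xz → ⊥-elim (1+n≢0 (trans xz z≡))) ]
      (path-adj⇒consecutive zx)
    where zu = trans (cong suc z≡) (sym u≡)

  forcedAt-upward : ForcedAt 0 → ∀ j → ForcedAt j × ForcedAt (suc j)
  forcedAt-upward f₀ zero = f₀ , forcedAt-one f₀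
  forcedAt-upward f₀ (suc j) with forcedAt-upward f₀ j
  ... | fj , fj′ = fj′ , forcedAt-next fj fj′

  forcedAt-downward : ∀ k → suc k < n → ForcedAt k → ForcedAt (suc k) → ForcedAt 0
  forcedAt-downward zero    _       f₀ _  = f₀
  forcedAt-downward (suc k) k+2<n fk fk′ =
    forcedAt-downward k (<-trans (n<1+n (suc k)) k+2<n) (forcedAt-prev k+2<n fk fk′) fk

  forcedAt-zero⇒forced : ForcedAt 0 → ∀ x → Forced (path n) S x
  forcedAt-zero⇒forced f₀ x = proj₁ (forcedAt-upward f₀ (toℕ x)) x refl

  member⇒forcedAt : ∀ {x} → x ∈ S → ForcedAt (toℕ x)
  member⇒forcedAt x∈S y y≡ = init (subst (_∈ S) (sym (toℕ-injective y≡)) x∈S)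

NoAdjacent : Subset n → Set
NoAdjacent S = ∀ {x y} → x ∈ S → y ∈ S → suc (toℕ x) ≢ toℕ y

noAdjacent-tail : ∀ {b} {p : Subset n} → NoAdjacent (b ∷ p) → NoAdjacent p
noAdjacent-tail noAdj x∈p y∈p = noAdj (there x∈p) (there y∈p) ∘ cong suc

noAdjacent⇒∣p∣≤⌈n/2⌉ : (p : Subset n) → NoAdjacent p → ∣ p ∣ ≤ ⌈ n /2⌉
noAdjacent⇒∣p∣≤⌈n/2⌉ []                      _     = z≤n
noAdjacent⇒∣p∣≤⌈n/2⌉ (outside ∷ p)           noAdj =
  ≤-trans (noAdjacent⇒∣p∣≤⌈n/2⌉ p (noAdjacent-tail noAdj)) (⌈n/2⌉-mono (n≤1+n _))
noAdjacent⇒∣p∣≤⌈n/2⌉ (inside ∷ [])           _     = s≤s z≤n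
noAdjacent⇒∣p∣≤⌈n/2⌉ (inside ∷ inside ∷ p)   noAdj = contradiction refl (noAdj here (there here))
noAdjacent⇒∣p∣≤⌈n/2⌉ (inside ∷ outside ∷ p)  noAdj =
  s≤s (noAdjacent⇒∣p∣≤⌈n/2⌉ p (noAdjacent-tail (noAdjacent-tail noAdj)))

failed-path⇒noAdjacent : FailedZF (path n) S → NoAdjacent S
failed-path⇒noAdjacent {n = n} {S = S} (v , unforced) {x} {y} x∈S y∈S xy =
  unforced (forcedAt-zero⇒forced (forcedAt-downward (toℕ x) x+1<n
    (member⇒forcedAt x∈S) (subst ForcedAt (sym xy) (member⇒forcedAt y∈S))) v)
  where
  open PathForcing S
  x+1<n = subst (_< n) (sym xy) (toℕ<n y)

failed-path⇒zero∉ : FailedZF (path (suc n)) S → zero ∉ S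
failed-path⇒zero∉ {S = S} (v , unforced) 0∈S =
  unforced (forcedAt-zero⇒forced (member⇒forcedAt 0∈S) v)
  where open PathForcing S

m*2≡m+m : ∀ m → m * 2 ≡ m + m
m*2≡m+m m = trans (*-comm m 2) (cong (m +_) (+-identityʳ m))

failed-oddPath⇒∣S∣≤k : ∀ k (S : Subset (suc (k * 2))) → FailedZF (path (suc (k * 2))) S → ∣ S ∣ ≤ k
failed-oddPath⇒∣S∣≤k k (inside ∷ _) failed = contradiction here (failed-path⇒zero∉ failed)
failed-oddPath⇒∣S∣≤k k (outside ∷ S) failed =
  subst (∣ S ∣ ≤_) (trans (cong ⌈_/2⌉ (m*2≡m+m k)) (sym (n≡⌈n+n/2⌉ k)))
    (noAdjacent⇒∣p∣≤⌈n/2⌉ S (noAdjacent-tail (failed-path⇒noAdjacent failed)))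

-- Odd paths have suc (k * 2) vertices rather than suc (k + k), since suc k * 2 reduces
-- to suc (suc (k * 2)) and so lets oddVertices recurse two vertices at a time.
oddVertices : ∀ k → Subset (suc (k * 2))
oddVertices zero    = outside ∷ []
oddVertices (suc k) = outside ∷ inside ∷ oddVertices k

∣oddVertices∣≡k : ∀ k → ∣ oddVertices k ∣ ≡ k
∣oddVertices∣≡k zero    = refl
∣oddVertices∣≡k (suc k) = cong suc (∣oddVertices∣≡k k)

zero∉oddVertices : ∀ k → zero ∉ oddVertices k
zero∉oddVertices zero    ()
zero∉oddVertices (suc k) ()

oddVertex-flanked : ∀ k {w} → w ∈ oddVertices k →
  ∃₂ λ a c → suc (toℕ a) ≡ toℕ w × suc (toℕ w) ≡ toℕ c × a ∉ oddVertices k × c ∉ oddVertices k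
oddVertex-flanked k {zero} 0∈ = contradiction 0∈ (zero∉oddVertices k)
oddVertex-flanked (suc k) (there here) =
  zero , suc (suc zero) , refl , refl , (λ ()) , λ { (there (there 0∈)) → zero∉oddVertices k 0∈ }
oddVertex-flanked (suc k) (there (there w∈)) with oddVertex-flanked k w∈
... | a , c , aw , wc , a∉ , c∉ =
  suc (suc a) , suc (suc c) , cong (λ i → suc (suc i)) aw , cong (λ i → suc (suc i)) wc ,
  (λ { (there (there a∈)) → a∉ a∈ }) , λ { (there (there c∈)) → c∉ c∈ }

oddVertices-stalled : ∀ k → Stalled (path (suc (k * 2))) (oddVertices k)
oddVertices-stalled k w∈ wu u∉ with oddVertex-flanked k w∈
... | a , c , aw , wc , a∉ , c∉ =
  [ (λ { refl → c , path-adj⁺ wc , a≢c ∘ sym , c∉ })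
  , (λ { refl → a , path-adj⁻ aw , a≢c , a∉ }) ] (path-neighbours aw wc wu)
  where
  a≢c : a ≢ c
  a≢c a≡c = m≢1+n+m (toℕ a) (trans (cong toℕ a≡c) (sym (trans (cong suc aw) wc)))

oddPath-failedZFNumber : ∀ k → IsFailedZFNumber (path (suc (k * 2))) k
oddPath-failedZFNumber k =
  (oddVertices k , stalled⇒failed (oddVertices-stalled k) (zero∉oddVertices k) , ∣oddVertices∣≡k k) ,
  failed-oddPath⇒∣S∣≤k k

theorem2p2 : (N : ℕ) → N ≥ 1 →
    ∃ λ n → ∃ λ m → Σ (Graph n) λ G → Σ (Graph m) λ H →
      IsSupergraph G H ×
      ∃ λ fG → ∃ λ fH →
        IsFailedZFNumber G fG × IsFailedZFNumber H fH × fG ≥ fH + N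
theorem2p2 N _ =
  suc (N * 2) , suc (N * 2) , edgeless _ , path _ , edgeless-isSupergraph (path _) ,
  N * 2 , N , edgeless-failedZFNumber (N * 2) , oddPath-failedZFNumber N ,
  ≤-reflexive (sym (m*2≡m+m N))
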